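{- There exist infinitely many numerical semigroups $S$ such that $h(S)=4$ and $S$ has at least one child in the ordinarization tree $\mathcal{T}_{g(S)}$.
   Context: For a numerical semigroup $S$ (additive submonoid of $\mathbb{N}_0$ with finite complement), $F(S)$ is the largest gap, $m(S)$ the smallest nonzero element, and $g(S)$ the number of gaps. $S_g=\{0,g+1,g+2,\ldots\}$. A numerical semigroup $S'\neq S_g$ of genus $g$ is a child of $S$ in $\mathcal{T}_g$ if $S'\cup\{F(S')\}\setminus\{m(S')\}=S$. $h(S)$ is the number of minimal generators of $S$ larger than $F(S)$. -}

module Defs where

open import Data.Nat using (ℕ; zero; suc; _+_; _≤_; _<_)
open import Data.Bool using (Bool; true; false)
open import Data.List using (List; length)
open import Data.List.Membership.Propositional using (_∈_)
open import Data.List.Relation.Unary.Unique.Propositional using (Unique)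
open import Data.Product using (Σ; ∃; _×_; _,_)
open import Data.Sum using (_⊎_)
open import Relation.Nullary using (¬_)
open import Relation.Binary.PropositionalEquality using (_≡_; _≢_)
open import Function.Bundles using (_⇔_)

record NumericalSemigroup : Set where
  field
    mem      : ℕ → Bool
    zero∈    : mem 0 ≡ true
    closed   : ∀ a b → mem a ≡ true → mem b ≡ true → mem (a + b) ≡ true
    cofinite : ∃ λ N → ∀ n → N ≤ n → mem n ≡ true

open NumericalSemigroup public

_∈S_ : ℕ → NumericalSemigroup → Set
n ∈S S = mem S n ≡ true

_∉S_ : ℕ → NumericalSemigroup → Set
n ∉S S = ¬ (n ∈S S)

SameSet : NumericalSemigroup → NumericalSemigroup → Set
SameSet S T = ∀ n → (n ∈S S) ⇔ (n ∈S T)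

HasGenus : NumericalSemigroup → ℕ → Set
HasGenus S g = Σ (List ℕ) λ gaps →
  Unique gaps × length gaps ≡ g × (∀ x → (x ∈ gaps) ⇔ (x ∉S S))

IsFrobenius : NumericalSemigroup → ℕ → Set
IsFrobenius S f = f ∉S S × (∀ n → f < n → n ∈S S)

IsMultiplicity : NumericalSemigroup → ℕ → Set
IsMultiplicity S m = m ∈S S × m ≢ 0 × (∀ x → x ∈S S → x ≢ 0 → m ≤ x)

-- x is larger than F(S) (with the convention F(ℕ) = -1): every y ≥ x lies in S,
-- i.e. no gap is ≥ x.
AboveFrobenius : NumericalSemigroup → ℕ → Set
AboveFrobenius S x = ∀ y → x ≤ y → y ∈S S

IsMinimalGenerator : NumericalSemigroup → ℕ → Set
IsMinimalGenerator S x =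
  x ∈S S × x ≢ 0 ×
  ¬ (Σ ℕ λ a → Σ ℕ λ b → a ∈S S × b ∈S S × a ≢ 0 × b ≢ 0 × a + b ≡ x)

HasH : NumericalSemigroup → ℕ → Set
HasH S k = Σ (List ℕ) λ gens →
  Unique gens × length gens ≡ k ×
  (∀ x → (x ∈ gens) ⇔ (IsMinimalGenerator S x × AboveFrobenius S x))

IsOrdinary : ℕ → NumericalSemigroup → Set
IsOrdinary g S' = ∀ n → (n ∈S S') ⇔ (n ≡ 0 ⊎ g < n)

IsChild : NumericalSemigroup → NumericalSemigroup → Set
IsChild S' S = Σ ℕ λ g → HasGenus S g × HasGenus S' g × ¬ IsOrdinary g S' ×
  Σ ℕ λ f → Σ ℕ λ m → IsFrobenius S' f × IsMultiplicity S' m ×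
  (∀ n → (n ∈S S) ⇔ ((n ∈S S' ⊎ n ≡ f) × n ≢ m))

-- Take S_i = {0} ∪ [m, c] ∪ (F, ∞) with m = 7 + 2i, c = 8 + 3i, F = 9 + 4i. Since F < 2m,
-- every sum of two nonzero elements lies above F, so S_i is a semigroup, and no element below
-- 2m is such a sum; every x ≥ 2m is one (as m + (x − m) or c + (x − c), using m + F = 2c).
-- Hence the minimal generators above F are F + 1, …, 2m − 1, four of them. Adding m − 1 and
-- removing F + 2 < 2(m − 1) gives, by the same criterion, a semigroup of the same genus with
-- Frobenius number F + 2 and multiplicity m − 1: a child of S_i.

module Submission where

open import Defs
open import Data.Nat using (ℕ)
open import Data.Product using (Σ; ∃; _×_)
open import Relation.Binary.PropositionalEquality using (_≡_)

open import Data.Nat using (zero; suc; _+_; _*_; _∸_; _≤_; _<_; _≤ᵇ_; z≤n; s≤s; s≤s⁻¹; _≟_; _≤?_; _<?_)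
open import Data.Nat.Properties
open import Data.Nat.Tactic.RingSolver using (solve-∀)
open import Data.Bool using (T; true)
open import Data.List using (List; _∷_; _++_; length; applyUpTo)
open import Data.List.Properties using (length-++; length-applyUpTo)
open import Data.List.Membership.Propositional using (_∈_)
open import Data.List.Membership.Propositional.Properties using (∈-applyUpTo⁺; ∈-applyUpTo⁻; ∈-++⁺ˡ; ∈-++⁺ʳ; ∈-++⁻)
open import Data.List.Relation.Unary.Any using (here; there)
open import Data.List.Relation.Unary.All.Properties using (¬Any⇒All¬)
open import Data.List.Relation.Unary.AllPairs using (_∷_)
open import Data.List.Relation.Unary.Unique.Propositional using (Unique)
open import Data.List.Relation.Unary.Unique.Propositional.Properties using (applyUpTo⁺₁; ++⁺)
open import Data.List.Relation.Binary.Disjoint.Propositional using (Disjoint)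
open import Data.Product using (_,_; proj₁; proj₂)
open import Data.Sum using (_⊎_; inj₁; inj₂)
open import Data.Empty using (⊥-elim)
open import Relation.Nullary using (¬_; ¬?; yes; no; does)
open import Relation.Nullary.Decidable using (dec-true; proof; _⊎-dec_; _×-dec_)
open import Relation.Nullary.Reflects using (Reflects; invert)
open import Relation.Unary using (Decidable)
open import Relation.Binary.PropositionalEquality using (_≢_; refl; sym; trans; cong; cong₂; subst; ≢-sym)
open import Function using (_∘_)
open import Function.Bundles using (Equivalence; mk⇔; _⇔_)

open Equivalence using (to; from)

range : ℕ → ℕ → List ℕ
range a n = applyUpTo (a +_) n

∈-range⁻ : ∀ {a n x} → x ∈ range a n → a ≤ x × x < a + n
∈-range⁻ {a} x∈ with i , i<n , refl ← ∈-applyUpTo⁻ (a +_) x∈ = m≤m+n a i , +-monoʳ-< a i<n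

∈-range⁺ : ∀ {a n x} → a ≤ x → x < a + n → x ∈ range a n
∈-range⁺ {a} {n} {x} a≤x x<a+n = subst (_∈ range a n) a+[x∸a]≡x
    (∈-applyUpTo⁺ (a +_) (+-cancelˡ-< a (x ∸ a) n (subst (_< a + n) (sym a+[x∸a]≡x) x<a+n)))
  where
  a+[x∸a]≡x : a + (x ∸ a) ≡ x
  a+[x∸a]≡x = m+[n∸m]≡n a≤x

range-unique : ∀ a n → Unique (range a n)
range-unique a n = applyUpTo⁺₁ (a +_) n (λ i<j _ → <⇒≢ (+-monoʳ-< a i<j))

length-range : ∀ a n → length (range a n) ≡ n
length-range a = length-applyUpTo (a +_)

range-disjoint : ∀ {a n b k} → a + n ≤ b → Disjoint (range a n) (range b k)
range-disjoint a+n≤b (x∈ , x∈′) =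
  <⇒≱ (<-≤-trans (proj₂ (∈-range⁻ x∈)) a+n≤b) (proj₁ (∈-range⁻ x∈′))

Decomposable : (ℕ → Set) → ℕ → Set
Decomposable P x = Σ ℕ λ a → Σ ℕ λ b → P a × P b × a ≢ 0 × b ≢ 0 × a + b ≡ x

decomposable-map : ∀ {P Q : ℕ → Set} {x} → (∀ {n} → P n → Q n) → Decomposable P x → Decomposable Q x
decomposable-map P⇒Q (a , b , pa , pb , rest) = a , b , P⇒Q pa , P⇒Q pb , rest

IsGapList : (ℕ → Set) → List ℕ → Set
IsGapList P gaps = Unique gaps × (∀ x → x ∈ gaps ⇔ (¬ P x))

-- A sum of two nonzero elements is at least m + m and hence again in P, so P is closed under +.
record SemigroupPredicate (P : ℕ → Set) (m : ℕ) : Set where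
  field
    decide         : Decidable P
    contains-0     : P 0
    nonzero-≥      : ∀ {n} → P n → n ≢ 0 → m ≤ n
    contains-≥m+m  : ∀ {n} → m + m ≤ n → P n

module _ {P : ℕ → Set} {m : ℕ} (sp : SemigroupPredicate P m) where
  open SemigroupPredicate sp

  sum-≥m+m : ∀ {a b} → P a → P b → a ≢ 0 → b ≢ 0 → m + m ≤ a + b
  sum-≥m+m pa pb a≢0 b≢0 = +-mono-≤ (nonzero-≥ pa a≢0) (nonzero-≥ pb b≢0)

  closed-+ : ∀ a b → P a → P b → P (a + b)
  closed-+ zero    b       pa pb = pb
  closed-+ (suc a) zero    pa pb = subst P (sym (+-identityʳ (suc a))) pa
  closed-+ (suc a) (suc b) pa pb = contains-≥m+m (sum-≥m+m pa pb (λ ()) (λ ()))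

  ∈⇒P : ∀ {n} → does (decide n) ≡ true → P n
  ∈⇒P {n} n∈ = invert (subst (Reflects (P n)) n∈ (proof (decide n)))

  P⇒∈ : ∀ {n} → P n → does (decide n) ≡ true
  P⇒∈ {n} = dec-true (decide n)

  toSemigroup : NumericalSemigroup
  toSemigroup = record
    { mem      = λ n → does (decide n)
    ; zero∈    = P⇒∈ contains-0
    ; closed   = λ a b a∈ b∈ → P⇒∈ (closed-+ a b (∈⇒P a∈) (∈⇒P b∈))
    ; cofinite = m + m , λ n m+m≤n → P⇒∈ (contains-≥m+m m+m≤n)
    }

  ¬decomposable-<m+m : ∀ {x} → x < m + m → ¬ Decomposable P x
  ¬decomposable-<m+m x<m+m (_ , _ , pa , pb , a≢0 , b≢0 , refl) =
    <⇒≱ x<m+m (sum-≥m+m pa pb a≢0 b≢0)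

  isMultiplicity : P m → m ≢ 0 → IsMultiplicity toSemigroup m
  isMultiplicity pm m≢0 = P⇒∈ pm , m≢0 , λ x x∈ x≢0 → nonzero-≥ (∈⇒P x∈) x≢0

  isFrobenius : ∀ {f} → ¬ P f → (∀ n → f < n → P n) → IsFrobenius toSemigroup f
  isFrobenius ¬pf above = ¬pf ∘ ∈⇒P , λ n f<n → P⇒∈ (above n f<n)

  hasGenus : ∀ {gaps g} → IsGapList P gaps → length gaps ≡ g → HasGenus toSemigroup g
  hasGenus {gaps} (unique , ∈gaps) refl = gaps , unique , refl ,
    λ x → mk⇔ (λ x∈ → to (∈gaps x) x∈ ∘ ∈⇒P) (λ x∉ → from (∈gaps x) (x∉ ∘ P⇒∈))

  -- The minimal generators above f are exactly f + 1, …, 2m − 1: those below 2m cannot split,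
  -- and everything from 2m on splits by assumption.
  hasH : ∀ {f k} → ¬ P f → (∀ n → f < n → P n) → (∀ {x} → m + m ≤ x → Decomposable P x) →
         suc f + k ≡ m + m → HasH toSemigroup k
  hasH {f} {k} ¬pf above decompose f+1+k≡m+m =
    range (suc f) k , range-unique (suc f) k , length-range (suc f) k , λ x → mk⇔ (⇒ x) (⇐ x)
    where
    ⇒ : ∀ x → x ∈ range (suc f) k → IsMinimalGenerator toSemigroup x × AboveFrobenius toSemigroup x
    ⇒ x x∈ with f<x , x<f+1+k ← ∈-range⁻ x∈ =
      (P⇒∈ (above x f<x) , m<n⇒n≢0 f<x ,
         ¬decomposable-<m+m (subst (x <_) f+1+k≡m+m x<f+1+k) ∘ decomposable-map ∈⇒P) ,
      λ y x≤y → P⇒∈ (above y (<-≤-trans f<x x≤y))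
    ⇐ : ∀ x → IsMinimalGenerator toSemigroup x × AboveFrobenius toSemigroup x → x ∈ range (suc f) k
    ⇐ x ((_ , _ , indecomposable) , x-above) = ∈-range⁺ f<x x<f+1+k
      where
      f<x : f < x
      f<x = ≰⇒> (λ x≤f → ¬pf (∈⇒P (x-above f x≤f)))
      x<f+1+k : x < suc f + k
      x<f+1+k = subst (x <_) (sym f+1+k≡m+m)
        (≰⇒> (λ m+m≤x → indecomposable (decomposable-map P⇒∈ (decompose m+m≤x))))

Without : (ℕ → Set) → ℕ → ℕ → Set
Without P x n = P n × n ≢ x

without : ∀ {P m x} → SemigroupPredicate P m → x ≢ 0 → x < m + m → SemigroupPredicate (Without P x) m
without {x = x} sp x≢0 x<m+m = record
  { decide        = λ n → decide n ×-dec ¬? (n ≟ x)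
  ; contains-0    = contains-0 , ≢-sym x≢0
  ; nonzero-≥     = λ (pn , _) → nonzero-≥ pn
  ; contains-≥m+m = λ m+m≤n → contains-≥m+m m+m≤n , >⇒≢ (<-≤-trans x<m+m m+m≤n)
  }
  where open SemigroupPredicate sp

gapList-without : ∀ {P x gaps} → P x → IsGapList P gaps → IsGapList (Without P x) (x ∷ gaps)
gapList-without {P} {x} {gaps} px (unique , ∈gaps) =
  ¬Any⇒All¬ gaps (λ x∈ → to (∈gaps x) x∈ px) ∷ unique , λ y → mk⇔ (⇒ y) (⇐ y)
  where
  ⇒ : ∀ y → y ∈ x ∷ gaps → ¬ Without P x y
  ⇒ y (here refl)  (_ , y≢x) = y≢x refl
  ⇒ y (there y∈)  (py , _)  = to (∈gaps y) y∈ py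
  ⇐ : ∀ y → ¬ Without P x y → y ∈ x ∷ gaps
  ⇐ y y∉ with y ≟ x
  ... | yes refl = here refl
  ... | no y≢x   = there (from (∈gaps y) (λ py → y∉ (py , y≢x)))

multiplicity-unique : ∀ {m n} S T → SameSet S T → IsMultiplicity S m → IsMultiplicity T n → m ≡ n
multiplicity-unique _ _ S≈T (m∈S , m≢0 , S-least) (n∈T , n≢0 , T-least) =
  ≤-antisym (S-least _ (from (S≈T _) n∈T) n≢0) (T-least _ (to (S≈T _) m∈S) m≢0)

¬ordinary : ∀ {m g} S → IsMultiplicity S m → m ≤ g → ¬ IsOrdinary g S
¬ordinary _ (m∈S , m≢0 , _) m≤g ordinary with to (ordinary _) m∈S
... | inj₁ m≡0 = m≢0 m≡0
... | inj₂ g<m = <⇒≱ g<m m≤g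

NonzeroMember : ℕ → ℕ → ℕ → ℕ → Set
NonzeroMember m c f n = (m ≤ n × n ≤ c) ⊎ f < n

Member : ℕ → ℕ → ℕ → ℕ → Set
Member m c f n = n ≡ 0 ⊎ NonzeroMember m c f n

member? : ∀ m c f → Decidable (Member m c f)
member? m c f n = (n ≟ 0) ⊎-dec ((m ≤? n) ×-dec (n ≤? c)) ⊎-dec (f <? n)

nonzeroMember⇒≢0 : ∀ {a c f n} → NonzeroMember (suc a) c f n → n ≢ 0
nonzeroMember⇒≢0 (inj₁ (a<n , _)) = m<n⇒n≢0 a<n
nonzeroMember⇒≢0 (inj₂ f<n)       = m<n⇒n≢0 f<n

member-semigroup : ∀ {m c f} → m ≤ suc f → f < m + m → SemigroupPredicate (Member m c f) m
member-semigroup {m} {c} {f} m≤1+f f<m+m = record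
  { decide        = member? m c f
  ; contains-0    = inj₁ refl
  ; nonzero-≥     = nonzero-≥
  ; contains-≥m+m = λ m+m≤n → inj₂ (inj₂ (<-≤-trans f<m+m m+m≤n))
  }
  where
  nonzero-≥ : ∀ {n} → Member m c f n → n ≢ 0 → m ≤ n
  nonzero-≥ (inj₁ n≡0)              n≢0 = ⊥-elim (n≢0 n≡0)
  nonzero-≥ (inj₂ (inj₁ (m≤n , _))) _   = m≤n
  nonzero-≥ (inj₂ (inj₂ f<n))       _   = ≤-trans m≤1+f f<n

¬member-low : ∀ {m c f x} → x ≢ 0 → x < m → m ≤ suc f → ¬ Member m c f x
¬member-low x≢0 x<m m≤1+f (inj₁ x≡0)              = x≢0 x≡0
¬member-low x≢0 x<m m≤1+f (inj₂ (inj₁ (m≤x , _))) = <⇒≱ x<m m≤x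
¬member-low x≢0 x<m m≤1+f (inj₂ (inj₂ f<x))       = <⇒≱ (<-≤-trans x<m m≤1+f) f<x

¬member-high : ∀ {m c f x} → c < x → x ≤ f → ¬ Member m c f x
¬member-high c<x x≤f (inj₁ refl)             = <⇒≱ c<x z≤n
¬member-high c<x x≤f (inj₂ (inj₁ (_ , x≤c))) = <⇒≱ c<x x≤c
¬member-high c<x x≤f (inj₂ (inj₂ f<x))       = <⇒≱ f<x x≤f

memberGaps : ℕ → ℕ → ℕ → List ℕ
memberGaps a c f = range 1 a ++ range (suc c) (f ∸ c)

length-memberGaps : ∀ a c f → length (memberGaps a c f) ≡ a + (f ∸ c)
length-memberGaps a c f =
  trans (length-++ (range 1 a)) (cong₂ _+_ (length-range 1 a) (length-range (suc c) (f ∸ c)))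

member-gapList : ∀ {a c f} → a ≤ c → c ≤ f → IsGapList (Member (suc a) c f) (memberGaps a c f)
member-gapList {a} {c} {f} a≤c c≤f =
  ++⁺ (range-unique 1 a) (range-unique (suc c) (f ∸ c)) (range-disjoint (s≤s a≤c)) ,
  λ x → mk⇔ (⇒ x) (⇐ x)
  where
  1+c+[f∸c]≡1+f : suc c + (f ∸ c) ≡ suc f
  1+c+[f∸c]≡1+f = cong suc (m+[n∸m]≡n c≤f)
  ⇒ : ∀ x → x ∈ memberGaps a c f → ¬ Member (suc a) c f x
  ⇒ x x∈ with ∈-++⁻ (range 1 a) x∈
  ... | inj₁ x∈low  with 0<x , x<1+a ← ∈-range⁻ x∈low =
    ¬member-low (>⇒≢ 0<x) x<1+a (s≤s (≤-trans a≤c c≤f))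
  ... | inj₂ x∈high with c<x , x<1+c+[f∸c] ← ∈-range⁻ x∈high =
    ¬member-high c<x (s≤s⁻¹ (subst (x <_) 1+c+[f∸c]≡1+f x<1+c+[f∸c]))
  ⇐ : ∀ x → ¬ Member (suc a) c f x → x ∈ memberGaps a c f
  ⇐ x x∉ with x ≟ 0 | x ≤? a | x ≤? c | x ≤? f
  ... | yes x≡0 | _       | _       | _       = ⊥-elim (x∉ (inj₁ x≡0))
  ... | no x≢0  | yes x≤a | _       | _       = ∈-++⁺ˡ (∈-range⁺ (n≢0⇒n>0 x≢0) (s≤s x≤a))
  ... | no _    | no x≰a  | yes x≤c | _       = ⊥-elim (x∉ (inj₂ (inj₁ (≰⇒> x≰a , x≤c))))
  ... | no _    | no _    | no x≰c  | yes x≤f =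
    ∈-++⁺ʳ (range 1 a) (∈-range⁺ (≰⇒> x≰c) (subst (x <_) (sym 1+c+[f∸c]≡1+f) (s≤s x≤f)))
  ... | no _    | no _    | no _    | no x≰f  = ⊥-elim (x∉ (inj₂ (inj₂ (≰⇒> x≰f))))

decomposable-∸ : ∀ {a c f x y} → NonzeroMember (suc a) c f y → y ≤ x →
                 NonzeroMember (suc a) c f (x ∸ y) → Decomposable (Member (suc a) c f) x
decomposable-∸ {x = x} {y} y∈ y≤x x∸y∈ =
  y , x ∸ y , inj₂ y∈ , inj₂ x∸y∈ , nonzeroMember⇒≢0 y∈ , nonzeroMember⇒≢0 x∸y∈ , m+[n∸m]≡n y≤x

-- Split x ≥ 2m as m + (x − m), c + (x − c) or m + (x − m) according as
-- x ≤ m + c, x ≤ c + c or x > c + c ≥ m + f.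
member-decomposable : ∀ {a c f x} → suc a ≤ c → suc a + f ≤ c + c → suc a + suc a ≤ x →
                      Decomposable (Member (suc a) c f) x
member-decomposable {a} {c} {f} {x} m≤c m+f≤c+c m+m≤x with x ≤? suc a + c | x ≤? c + c
... | yes x≤m+c | _ =
  decomposable-∸ (inj₁ (≤-refl , m≤c)) (m+n≤o⇒m≤o (suc a) m+m≤x)
    (inj₁ (m+n≤o⇒m≤o∸n (suc a) m+m≤x , m≤n+o⇒m∸n≤o x (suc a) x≤m+c))
... | no x≰m+c | yes x≤c+c =
  decomposable-∸ (inj₁ (m≤c , ≤-refl)) (≤-trans (m≤n+m c (suc a)) m+c≤x)
    (inj₁ (m+n≤o⇒m≤o∸n (suc a) m+c≤x , m≤n+o⇒m∸n≤o x c x≤c+c))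
  where
  m+c≤x : suc a + c ≤ x
  m+c≤x = <⇒≤ (≰⇒> x≰m+c)
... | no _ | no x≰c+c =
  decomposable-∸ (inj₁ (≤-refl , m≤c)) (m+n≤o⇒m≤o (suc a) m+m≤x)
    (inj₂ (m+n≤o⇒m≤o∸n (suc f) f+1+m≤x))
  where
  f+1+m≤x : suc f + suc a ≤ x
  f+1+m≤x = subst (λ t → suc t ≤ x) (+-comm (suc a) f) (≤-trans (s≤s m+f≤c+c) (≰⇒> x≰c+c))

member-hasH : ∀ {a c f k} → suc a ≤ c → c < f → suc a + f ≤ c + c → suc f + k ≡ suc a + suc a →
              (sp : SemigroupPredicate (Member (suc a) c f) (suc a)) → HasH (toSemigroup sp) k
member-hasH m≤c c<f m+f≤c+c f+1+k≡m+m sp =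
  hasH sp (¬member-high c<f ≤-refl) (λ _ f<n → inj₂ (inj₂ f<n)) (member-decomposable m≤c m+f≤c+c)
    f+1+k≡m+m

member-suc⁻ : ∀ {m c f n} → m ≢ 0 → m ≤ f → Member (suc m) c f n → Member m c f n × n ≢ m
member-suc⁻ m≢0 _   (inj₁ refl)               = inj₁ refl , ≢-sym m≢0
member-suc⁻ _   _   (inj₂ (inj₁ (m<n , n≤c))) = inj₂ (inj₁ (<⇒≤ m<n , n≤c)) , >⇒≢ m<n
member-suc⁻ _   m≤f (inj₂ (inj₂ f<n))         = inj₂ (inj₂ f<n) , >⇒≢ (≤-<-trans m≤f f<n)

member-suc⁺ : ∀ {m c f n} → Member m c f n → n ≢ m → Member (suc m) c f n
member-suc⁺ (inj₁ n≡0)                _   = inj₁ n≡0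
member-suc⁺ (inj₂ (inj₁ (m≤n , n≤c))) n≢m = inj₂ (inj₁ (≤∧≢⇒< m≤n (≢-sym n≢m) , n≤c))
member-suc⁺ (inj₂ (inj₂ f<n))         _   = inj₂ (inj₂ f<n)

-- With E = {0} ∪ [m − 1, c] ∪ (f, ∞), the parent is S = E ∖ {m − 1} and the child is
-- S′ = E ∖ {f + 2}; each has the gaps of E plus one.
member-child : ∀ {b c f} → suc b ≤ c → c ≤ f → suc (suc f) < suc b + suc b →
               (sp : SemigroupPredicate (Member (suc (suc b)) c f) (suc (suc b))) →
               ∃ λ S′ → IsChild S′ (toSemigroup sp)
member-child {b} {c} {f} m′≤c c≤f F′<m′+m′ sp =
  toSemigroup child , suc b + (f ∸ c) ,
  hasGenus sp (member-gapList m′≤c c≤f) (length-memberGaps (suc b) c f) ,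
  hasGenus child (gapList-without F′∈E (member-gapList (≤-trans (n≤1+n b) m′≤c) c≤f))
           (cong suc (length-memberGaps b c f)) ,
  ¬ordinary (toSemigroup child) multiplicity (m≤m+n (suc b) (f ∸ c)) ,
  F′ , suc b , frobenius , multiplicity , parent
  where
  F′ : ℕ
  F′ = suc (suc f)
  m′≤f : suc b ≤ f
  m′≤f = ≤-trans m′≤c c≤f
  f<F′ : f < F′
  f<F′ = m<n⇒m<1+n (n<1+n f)
  E : SemigroupPredicate (Member (suc b) c f) (suc b)
  E = member-semigroup (m≤n⇒m≤1+n m′≤f) (<-trans f<F′ F′<m′+m′)
  F′∈E : Member (suc b) c f F′
  F′∈E = inj₂ (inj₂ f<F′)
  child : SemigroupPredicate (Without (Member (suc b) c f) F′) (suc b)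
  child = without E (λ ()) F′<m′+m′
  frobenius : IsFrobenius (toSemigroup child) F′
  frobenius = isFrobenius child (λ (_ , F′≢F′) → F′≢F′ refl)
                (λ n F′<n → inj₂ (inj₂ (<-trans f<F′ F′<n)) , >⇒≢ F′<n)
  multiplicity : IsMultiplicity (toSemigroup child) (suc b)
  multiplicity =
    isMultiplicity child (inj₂ (inj₁ (≤-refl , m′≤c)) , <⇒≢ (s≤s (m≤n⇒m≤1+n m′≤f))) (λ ())
  parent : ∀ n → n ∈S toSemigroup sp ⇔ ((n ∈S toSemigroup child ⊎ n ≡ F′) × n ≢ suc b)
  parent n = mk⇔ ⇒ ⇐
    where
    ⇒ : n ∈S toSemigroup sp → (n ∈S toSemigroup child ⊎ n ≡ F′) × n ≢ suc b
    ⇒ n∈S with n∈E , n≢m′ ← member-suc⁻ (λ ()) m′≤f (∈⇒P sp n∈S) with n ≟ F′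
    ... | yes n≡F′ = inj₂ n≡F′ , n≢m′
    ... | no n≢F′  = inj₁ (P⇒∈ child (n∈E , n≢F′)) , n≢m′
    ⇐ : (n ∈S toSemigroup child ⊎ n ≡ F′) × n ≢ suc b → n ∈S toSemigroup sp
    ⇐ (inj₁ n∈S′ , n≢m′) = P⇒∈ sp (member-suc⁺ (proj₁ (∈⇒P child n∈S′)) n≢m′)
    ⇐ (inj₂ refl , n≢m′) = P⇒∈ sp (member-suc⁺ F′∈E n≢m′)

affine-≤ : ∀ a b c d i → {T (a ≤ᵇ b)} → {T (c ≤ᵇ d)} → a + c * i ≤ b + d * i
affine-≤ a b c d i {a≤b} {c≤d} = +-mono-≤ (≤ᵇ⇒≤ a b a≤b) (*-monoˡ-≤ i (≤ᵇ⇒≤ c d c≤d))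

f+1+4≡m+m : ∀ i → (10 + 4 * i) + 4 ≡ (7 + 2 * i) + (7 + 2 * i)
f+1+4≡m+m = solve-∀

m+f≡c+c : ∀ i → (7 + 2 * i) + (9 + 4 * i) ≡ (8 + 3 * i) + (8 + 3 * i)
m+f≡c+c = solve-∀

f+3≡m′+m′ : ∀ i → 12 + 4 * i ≡ (6 + 2 * i) + (6 + 2 * i)
f+3≡m′+m′ = solve-∀

family-semigroup : ∀ i → SemigroupPredicate (Member (7 + 2 * i) (8 + 3 * i) (9 + 4 * i)) (7 + 2 * i)
family-semigroup i =
  member-semigroup (affine-≤ 7 10 2 4 i) (≤-trans (m≤m+n (10 + 4 * i) 4) (≤-reflexive (f+1+4≡m+m i)))

family : ℕ → NumericalSemigroup
family i = toSemigroup (family-semigroup i)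

family-injective : ∀ i j → SameSet (family i) (family j) → i ≡ j
family-injective i j same =
  *-cancelˡ-≡ i j 2 (+-cancelˡ-≡ 7 _ _
    (multiplicity-unique (family i) (family j) same (multiplicity i) (multiplicity j)))
  where
  multiplicity : ∀ k → IsMultiplicity (family k) (7 + 2 * k)
  multiplicity k =
    isMultiplicity (family-semigroup k) (inj₂ (inj₁ (≤-refl , affine-≤ 7 8 2 3 k))) (λ ())

mainTheorem11 : Σ (ℕ → NumericalSemigroup) λ T →
    (∀ i j → SameSet (T i) (T j) → i ≡ j) ×
    (∀ i → HasH (T i) 4 × ∃ λ S' → IsChild S' (T i))
mainTheorem11 = family , family-injective , λ i →
  member-hasH (affine-≤ 7 8 2 3 i) (affine-≤ 9 9 3 4 i) (≤-reflexive (m+f≡c+c i)) (f+1+4≡m+m i)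
              (family-semigroup i) ,
  member-child (affine-≤ 6 8 2 3 i) (affine-≤ 8 9 3 4 i) (≤-reflexive (f+3≡m′+m′ i)) (family-semigroup i)
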